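{- If $G$ is a graph with minimum degree $\delta(G)\ge 2$ and $\beta_0(G)=\Gamma(G)$, then $\beta_0(G)=\Gamma(G)=\Gamma_{\rm cer}(G)$.
   Context: All graphs are finite and simple. $\beta_0(G)$ is the independence number of $G$ (maximum size of an independent set of vertices). A dominating set of $G$ is a set $D\subseteq V_G$ such that every vertex of $V_G-D$ has a neighbor in $D$; $\Gamma(G)$ is the maximum cardinality of a minimal (with respect to inclusion) dominating set. A certified dominating set is a dominating set $D$ such that every vertex in $D$ has either zero or at least two neighbors in $V_G-D$; $\Gamma_{\rm cer}(G)$ is the maximum cardinality of a minimal (with respect to inclusion) certified dominating set of $G$. -}

module Defs where

open import Data.Nat using (ℕ; _≤_)
open import Data.Fin using (Fin)
open import Data.Bool using (Bool; true; false; T)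
open import Data.Vec using (tabulate)
open import Data.Fin.Subset using (Subset; _∈_; _∉_; _⊂_; ∣_∣)
open import Data.Product using (Σ; _×_; ∃; ∃-syntax)
open import Data.Sum using (_⊎_)
open import Relation.Nullary using (¬_)
open import Relation.Binary.PropositionalEquality using (_≡_; _≢_)

record Graph (n : ℕ) : Set where
  field
    adj   : Fin n → Fin n → Bool
    sym   : ∀ u v → adj u v ≡ adj v u
    irrefl : ∀ v → adj v v ≡ false

open Graph public

module _ {n : ℕ} (G : Graph n) where

  Adj : Fin n → Fin n → Set
  Adj u v = T (adj G u v)

  nbhd : Fin n → Subset n
  nbhd v = tabulate (λ u → adj G v u)

  degree : Fin n → ℕ
  degree v = ∣ nbhd v ∣

  MinDegreeAtLeast : ℕ → Set
  MinDegreeAtLeast k = ∀ v → k ≤ degree v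

  Independent : Subset n → Set
  Independent S = ∀ u v → u ∈ S → v ∈ S → ¬ Adj u v

  Dominating : Subset n → Set
  Dominating D = ∀ v → v ∉ D → ∃[ u ] (u ∈ D × Adj u v)

  MinimalDominating : Subset n → Set
  MinimalDominating D = Dominating D × (∀ D' → D' ⊂ D → ¬ Dominating D')

  Certified : Subset n → Set
  Certified D =
    ∀ v → v ∈ D →
      (∀ u → Adj v u → u ∈ D)
      ⊎ (∃[ u ] ∃[ w ] (u ≢ w × Adj v u × u ∉ D × Adj v w × w ∉ D))

  CertifiedDominating : Subset n → Set
  CertifiedDominating D = Dominating D × Certified D

  MinimalCertifiedDominating : Subset n → Set
  MinimalCertifiedDominating D =
    CertifiedDominating D × (∀ D' → D' ⊂ D → ¬ CertifiedDominating D')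

  IsMaxCard : (Subset n → Set) → ℕ → Set
  IsMaxCard P k = (∃[ S ] (P S × ∣ S ∣ ≡ k)) × (∀ S → P S → ∣ S ∣ ≤ k)

  IndependenceNumber : ℕ → Set
  IndependenceNumber = IsMaxCard Independent

  UpperDomination : ℕ → Set
  UpperDomination = IsMaxCard MinimalDominating

  UpperCertifiedDomination : ℕ → Set
  UpperCertifiedDomination = IsMaxCard MinimalCertifiedDominating

-- A maximum independent set S is dominating (a vertex with no neighbour in S could be added
-- to it), certified (by δ ≥ 2 every vertex of S has two neighbours, all outside S) and minimal
-- (a vertex of S missing from a subset of S is not dominated by it); so Γ_cer ≥ β₀ = k.
-- Conversely, when δ ≥ 2 every minimal certified dominating set D is minimal dominating, so
-- Γ_cer ≤ Γ = k. The point is that every vertex of D has a neighbour outside D. Otherwise, let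
-- B be the vertices of D with a neighbour outside D and I a maximal independent set among the
-- vertices of D with no neighbour outside D and none in B: then B ∪ I is a strictly smaller
-- certified dominating set. Certification then gives every vertex of D two neighbours outside
-- D, so D − x is certified, and it is dominating as soon as some subset of it is.
module Submission where

open import Defs
open import Data.Nat using (ℕ; zero; suc; _≤_; _<_; _+_; s≤s)
open import Data.Nat.Properties using (module ≤-Reasoning; ≤-trans; <⇒≱; m≤m+n; +-suc; +-monoʳ-≤)
open import Data.Fin using (Fin; zero; suc)
open import Data.Fin.Properties using (any?; all?; suc-injective)
open import Data.Fin.Subset
  using (Subset; _∈_; _∉_; _⊆_; _⊂_; ∣_∣; ⁅_⁆; _∪_; _-_; ⊥; Nonempty; inside; outside)
open import Data.Fin.Subset.Properties
  using (_∈?_; ∉⊥; ∣p∣≤n; x∈⁅x⁆; x∈⁅y⁆⇒x≡y; x∈p∪q⁺; x∈p∪q⁻; p⊆p∪q; p⊂q⇒∣p∣<∣q∣;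
         p─q⊆p; x∈p⇒p-x⊂p; x∈p∧x≢y⇒x∈p-y)
open import Data.Bool using (Bool; true; T)
open import Data.Bool.Properties using (T-≡)
open import Data.Vec using (_∷_; tabulate; here; there)
open import Data.Vec.Properties using (lookup∘tabulate; []=⇒lookup; lookup⇒[]=)
open import Data.Product using (_×_; _,_; proj₁; proj₂; ∃₂; ∃-syntax)
open import Data.Sum using (_⊎_; inj₁; inj₂; [_,_])
open import Data.Empty using (⊥-elim)
open import Function using (_∘_; Equivalence)
open import Relation.Nullary using (¬_; Dec; yes; no; contradiction)
open import Relation.Nullary.Decidable using (T?; isYes; toWitness; fromWitness; _×-dec_; _⊎-dec_; _→-dec_; ¬?)
open import Relation.Binary.PropositionalEquality using (_≡_; _≢_; refl; trans; subst) renaming (sym to ≡-sym)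

private
  variable
    n : ℕ

∈-tabulate⁺ : {f : Fin n → Bool} {x : Fin n} → f x ≡ true → x ∈ tabulate f
∈-tabulate⁺ {f = f} {x} fx≡true = lookup⇒[]= x _ (trans (lookup∘tabulate f x) fx≡true)

∈-tabulate⁻ : {f : Fin n → Bool} {x : Fin n} → x ∈ tabulate f → f x ≡ true
∈-tabulate⁻ {f = f} {x} x∈f = trans (≡-sym (lookup∘tabulate f x)) ([]=⇒lookup x∈f)

module _ {P : Fin n → Set} (P? : ∀ x → Dec (P x)) where

  select : Subset n
  select = tabulate (isYes ∘ P?)

  ∈-select⁺ : ∀ {x} → P x → x ∈ select
  ∈-select⁺ px = ∈-tabulate⁺ (Equivalence.to T-≡ (fromWitness px))

  ∈-select⁻ : ∀ {x} → x ∈ select → P x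
  ∈-select⁻ {x} x∈ = toWitness {a? = P? x} (Equivalence.from T-≡ (∈-tabulate⁻ x∈))

∣p∣>0⇒Nonempty : {p : Subset n} → 0 < ∣ p ∣ → Nonempty p
∣p∣>0⇒Nonempty {p = inside ∷ p}  _     = zero , here
∣p∣>0⇒Nonempty {p = outside ∷ p} ∣p∣>0 =
  let (x , x∈p) = ∣p∣>0⇒Nonempty ∣p∣>0 in suc x , there x∈p

∣p∣>1⇒∃-distinct : {p : Subset n} → 1 < ∣ p ∣ → ∃₂ λ x y → x ≢ y × x ∈ p × y ∈ p
∣p∣>1⇒∃-distinct {p = inside ∷ p} (s≤s ∣p∣>0) =
  let (y , y∈p) = ∣p∣>0⇒Nonempty ∣p∣>0 in zero , suc y , (λ ()) , here , there y∈p
∣p∣>1⇒∃-distinct {p = outside ∷ p} ∣p∣>1 =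
  let (x , y , x≢y , x∈p , y∈p) = ∣p∣>1⇒∃-distinct ∣p∣>1
  in suc x , suc y , x≢y ∘ suc-injective , there x∈p , there y∈p

x∉p⇒∣p∣<∣p∪⁅x⁆∣ : {p : Subset n} {x : Fin n} → x ∉ p → ∣ p ∣ < ∣ p ∪ ⁅ x ⁆ ∣
x∉p⇒∣p∣<∣p∪⁅x⁆∣ {x = x} x∉p = p⊂q⇒∣p∣<∣q∣ (p⊆p∪q _ , x , x∈p∪q⁺ (inj₂ (x∈⁅x⁆ x)) , x∉p)

module _ {P : Subset n → Set} (P? : ∀ S → Dec (P S)) where

  ∃-⁅⁆-maximal : P ⊥ → ∃[ S ] P S × (∀ v → v ∉ S → ¬ P (S ∪ ⁅ v ⁆))
  ∃-⁅⁆-maximal P⊥ = grow n ⊥ (m≤m+n n _) P⊥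
    where
    grow : ∀ fuel S → n ≤ fuel + ∣ S ∣ → P S → ∃[ T ] P T × (∀ v → v ∉ T → ¬ P (T ∪ ⁅ v ⁆))
    grow fuel S n≤ PS with any? (λ v → ¬? (v ∈? S) ×-dec P? (S ∪ ⁅ v ⁆))
    ... | no stuck = S , PS , λ v v∉S Pv → stuck (v , v∉S , Pv)
    ... | yes (v , v∉S , Pv) with fuel
    ...   | zero = contradiction (≤-trans (∣p∣≤n (S ∪ ⁅ v ⁆)) n≤) (<⇒≱ (x∉p⇒∣p∣<∣p∪⁅x⁆∣ v∉S))
    ...   | suc fuel′ = grow fuel′ (S ∪ ⁅ v ⁆) n≤′ Pv
      where
      open ≤-Reasoning
      n≤′ : n ≤ fuel′ + ∣ S ∪ ⁅ v ⁆ ∣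
      n≤′ = begin
        n                      ≤⟨ n≤ ⟩
        suc fuel′ + ∣ S ∣      ≡⟨ +-suc fuel′ ∣ S ∣ ⟨
        fuel′ + suc ∣ S ∣      ≤⟨ +-monoʳ-≤ fuel′ (x∉p⇒∣p∣<∣p∪⁅x⁆∣ v∉S) ⟩
        fuel′ + ∣ S ∪ ⁅ v ⁆ ∣  ∎

module _ (G : Graph n) where

  Adj-sym : ∀ {u v} → Adj G u v → Adj G v u
  Adj-sym {u} {v} = subst T (Graph.sym G u v)

  Adj-irrefl : ∀ {v} → ¬ Adj G v v
  Adj-irrefl {v} = subst T (Graph.irrefl G v)

  Adj? : ∀ u v → Dec (Adj G u v)
  Adj? u v = T? (adj G u v)

  ∈nbhd⇒Adj : ∀ {u v} → u ∈ nbhd G v → Adj G v u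
  ∈nbhd⇒Adj u∈ = Equivalence.from T-≡ (∈-tabulate⁻ u∈)

  two-neighbours : MinDegreeAtLeast G 2 → ∀ v → ∃₂ λ u w → u ≢ w × Adj G v u × Adj G v w
  two-neighbours δ≥2 v =
    let (u , w , u≢w , u∈ , w∈) = ∣p∣>1⇒∃-distinct (δ≥2 v) in u , w , u≢w , ∈nbhd⇒Adj u∈ , ∈nbhd⇒Adj w∈

  independent? : ∀ S → Dec (Independent G S)
  independent? S = all? λ u → all? λ v → (u ∈? S) →-dec (v ∈? S) →-dec ¬? (Adj? u v)

  independent-∪⁅⁆-or-adjacent : ∀ {S} → Independent G S → ∀ v →
    Independent G (S ∪ ⁅ v ⁆) ⊎ ∃[ u ] (u ∈ S × Adj G u v)
  independent-∪⁅⁆-or-adjacent {S} S-indep v with any? (λ u → (u ∈? S) ×-dec Adj? u v)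
  ... | yes adjacent = inj₂ adjacent
  ... | no ¬adjacent = inj₁ indep
    where
    indep : Independent G (S ∪ ⁅ v ⁆)
    indep x y x∈ y∈ with x∈p∪q⁻ S ⁅ v ⁆ x∈ | x∈p∪q⁻ S ⁅ v ⁆ y∈
    ... | inj₁ x∈S | inj₁ y∈S = S-indep x y x∈S y∈S
    ... | inj₁ x∈S | inj₂ y∈v with refl ← x∈⁅y⁆⇒x≡y v y∈v = λ a → ¬adjacent (x , x∈S , a)
    ... | inj₂ x∈v | inj₁ y∈S with refl ← x∈⁅y⁆⇒x≡y v x∈v = λ a → ¬adjacent (y , y∈S , Adj-sym a)
    ... | inj₂ x∈v | inj₂ y∈v with refl ← x∈⁅y⁆⇒x≡y v x∈v | refl ← x∈⁅y⁆⇒x≡y v y∈v = Adj-irrefl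

  Dominating-⊆ : ∀ {D D′} → D ⊆ D′ → Dominating G D → Dominating G D′
  Dominating-⊆ D⊆D′ D-dom v v∉D′ =
    let (u , u∈D , a) = D-dom v (v∉D′ ∘ D⊆D′) in u , D⊆D′ u∈D , a

  independent-dominating⇒minimal : ∀ {S} → Independent G S → Dominating G S →
    ∀ D → D ⊂ S → ¬ Dominating G D
  independent-dominating⇒minimal S-indep _ D (D⊆S , x , x∈S , x∉D) D-dom =
    let (u , u∈D , a) = D-dom x x∉D in S-indep u x (D⊆S u∈D) x∈S a

  maximum-independent⇒minimalCertifiedDominating : MinDegreeAtLeast G 2 → ∀ {S} →
    Independent G S → (∀ T → Independent G T → ∣ T ∣ ≤ ∣ S ∣) → MinimalCertifiedDominating G S
  maximum-independent⇒minimalCertifiedDominating δ≥2 {S} S-indep S-maximum =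
    (S-dom , S-certified) , λ D D⊂S (D-dom , _) → independent-dominating⇒minimal S-indep S-dom D D⊂S D-dom
    where
    S-dom : Dominating G S
    S-dom v v∉S with independent-∪⁅⁆-or-adjacent S-indep v
    ... | inj₂ adjacent = adjacent
    ... | inj₁ S∪v-indep = contradiction (S-maximum _ S∪v-indep) (<⇒≱ (x∉p⇒∣p∣<∣p∪⁅x⁆∣ v∉S))
    S-certified : Certified G S
    S-certified x x∈S =
      let (u , w , u≢w , au , aw) = two-neighbours δ≥2 x
      in inj₂ (u , w , u≢w , au , (λ u∈S → S-indep x u x∈S u∈S au) , aw , (λ w∈S → S-indep x w x∈S w∈S aw))

  OutsideNeighbour : Subset n → Fin n → Set
  OutsideNeighbour D v = ∃[ u ] (Adj G v u × u ∉ D)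

  outsideNeighbour? : ∀ D v → Dec (OutsideNeighbour D v)
  outsideNeighbour? D v = any? λ u → Adj? v u ×-dec ¬? (u ∈? D)

  ¬OutsideNeighbour⇒neighbour∈ : ∀ {D v u} → ¬ OutsideNeighbour D v → Adj G v u → u ∈ D
  ¬OutsideNeighbour⇒neighbour∈ {D} {u = u} ¬out a with u ∈? D
  ... | yes u∈D = u∈D
  ... | no u∉D = contradiction (u , a , u∉D) ¬out

  TwoOutsideNeighbours : Subset n → Fin n → Set
  TwoOutsideNeighbours D v = ∃[ u ] ∃[ w ] (u ≢ w × Adj G v u × u ∉ D × Adj G v w × w ∉ D)

  TwoOutsideNeighbours-⊆ : ∀ {X D v} → X ⊆ D → TwoOutsideNeighbours D v → TwoOutsideNeighbours X v
  TwoOutsideNeighbours-⊆ X⊆D (u , w , u≢w , au , u∉D , aw , w∉D) =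
    u , w , u≢w , au , u∉D ∘ X⊆D , aw , w∉D ∘ X⊆D

  certified⇒twoOutsideNeighbours : ∀ {D v} → Certified G D → v ∈ D →
    OutsideNeighbour D v → TwoOutsideNeighbours D v
  certified⇒twoOutsideNeighbours D-cert v∈D (u , a , u∉D) with D-cert _ v∈D
  ... | inj₁ closed = contradiction (closed u a) u∉D
  ... | inj₂ two = two

  module _ (D : Subset n) where

    Boundary : Fin n → Set
    Boundary x = x ∈ D × OutsideNeighbour D x

    boundary? : ∀ x → Dec (Boundary x)
    boundary? x = (x ∈? D) ×-dec outsideNeighbour? D x

    Deep : Fin n → Set
    Deep x = x ∈ D × ¬ OutsideNeighbour D x × ¬ (∃[ u ] (Adj G x u × Boundary u))

    deep? : ∀ x → Dec (Deep x)
    deep? x = (x ∈? D) ×-dec ¬? (outsideNeighbour? D x) ×-dec ¬? (any? λ u → Adj? x u ×-dec boundary? u)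

    IndependentDeep : Subset n → Set
    IndependentDeep S = (∀ x → x ∈ S → Deep x) × Independent G S

    independentDeep? : ∀ S → Dec (IndependentDeep S)
    independentDeep? S = (all? λ x → (x ∈? S) →-dec deep? x) ×-dec independent? S

  module Pruned (δ≥2 : MinDegreeAtLeast G 2) {D : Subset n} (D-cd : CertifiedDominating G D)
                (I : Subset n) (I-deep : ∀ x → x ∈ I → Deep D x) (I-indep : Independent G I)
                (I-maximal : ∀ v → v ∉ I → ¬ IndependentDeep D (I ∪ ⁅ v ⁆)) where

    pruned : Subset n
    pruned = select λ x → boundary? D x ⊎-dec (x ∈? I)

    pruned⊆D : pruned ⊆ D
    pruned⊆D x∈ = [ proj₁ , proj₁ ∘ I-deep _ ] (∈-select⁻ _ x∈)

    I-neighbour∉pruned : ∀ {x u} → x ∈ I → Adj G x u → u ∉ pruned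
    I-neighbour∉pruned {x} {u} x∈I a u∈ with ∈-select⁻ _ u∈
    ... | inj₁ u-boundary = proj₂ (proj₂ (I-deep x x∈I)) (u , a , u-boundary)
    ... | inj₂ u∈I = I-indep x u x∈I u∈I a

    pruned-dominating : Dominating G pruned
    pruned-dominating v v∉ with v ∈? D
    ... | no v∉D = let (u , u∈D , a) = proj₁ D-cd v v∉D in u , ∈-select⁺ _ (inj₁ (u∈D , v , a , v∉D)) , a
    ... | yes v∈D with any? (λ u → Adj? v u ×-dec boundary? D u)
    ...   | yes (u , a , u-boundary) = u , ∈-select⁺ _ (inj₁ u-boundary) , Adj-sym a
    ...   | no ¬boundary-neighbour with independent-∪⁅⁆-or-adjacent I-indep v
    ...     | inj₂ (u , u∈I , a) = u , ∈-select⁺ _ (inj₂ u∈I) , a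
    ...     | inj₁ I∪v-indep = contradiction (I∪v-deep , I∪v-indep) (I-maximal v (v∉ ∘ ∈-select⁺ _ ∘ inj₂))
      where
      v-deep : Deep D v
      v-deep = v∈D , (λ out → v∉ (∈-select⁺ _ (inj₁ (v∈D , out)))) , ¬boundary-neighbour
      I∪v-deep : ∀ x → x ∈ I ∪ ⁅ v ⁆ → Deep D x
      I∪v-deep x x∈ with x∈p∪q⁻ I ⁅ v ⁆ x∈
      ... | inj₁ x∈I = I-deep x x∈I
      ... | inj₂ x∈v with refl ← x∈⁅y⁆⇒x≡y v x∈v = v-deep

    pruned-certified : Certified G pruned
    pruned-certified x x∈ with ∈-select⁻ _ x∈
    ... | inj₁ (x∈D , out) =
      inj₂ (TwoOutsideNeighbours-⊆ pruned⊆D (certified⇒twoOutsideNeighbours (proj₂ D-cd) x∈D out))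
    ... | inj₂ x∈I =
      let (u , w , u≢w , au , aw) = two-neighbours δ≥2 x
      in inj₂ (u , w , u≢w , au , I-neighbour∉pruned x∈I au , aw , I-neighbour∉pruned x∈I aw)

    pruned⊂D : ∀ {a} → a ∈ D → ¬ OutsideNeighbour D a → pruned ⊂ D
    pruned⊂D {a} a∈D ¬out with a ∈? I
    ... | no a∉I = pruned⊆D , a , a∈D , [ ¬out ∘ proj₂ , a∉I ] ∘ ∈-select⁻ _
    ... | yes a∈I =
      let (u , _ , _ , au , _) = two-neighbours δ≥2 a
      in pruned⊆D , u , ¬OutsideNeighbour⇒neighbour∈ ¬out au , I-neighbour∉pruned a∈I au

  certifiedDominating-shrink : MinDegreeAtLeast G 2 → ∀ {D a} → CertifiedDominating G D →
    a ∈ D → ¬ OutsideNeighbour D a → ∃[ X ] X ⊂ D × CertifiedDominating G X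
  certifiedDominating-shrink δ≥2 {D} D-cd a∈D ¬out =
    let (I , (I-deep , I-indep) , I-maximal) = ∃-⁅⁆-maximal (independentDeep? D) ⊥-independentDeep
        open Pruned δ≥2 D-cd I I-deep I-indep I-maximal
    in pruned , pruned⊂D a∈D ¬out , pruned-dominating , pruned-certified
    where
    ⊥-independentDeep : IndependentDeep D ⊥
    ⊥-independentDeep = (λ _ → ⊥-elim ∘ ∉⊥) , (λ _ _ → ⊥-elim ∘ ∉⊥)

  minimalCertifiedDominating⇒outsideNeighbour : MinDegreeAtLeast G 2 → ∀ {D v} →
    MinimalCertifiedDominating G D → v ∈ D → OutsideNeighbour D v
  minimalCertifiedDominating⇒outsideNeighbour δ≥2 {D} {v} (D-cd , D-minimal) v∈D
    with outsideNeighbour? D v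
  ... | yes out = out
  ... | no ¬out = let (X , X⊂D , X-cd) = certifiedDominating-shrink δ≥2 D-cd v∈D ¬out
                  in contradiction X-cd (D-minimal X X⊂D)

  minimalCertifiedDominating⇒minimalDominating : MinDegreeAtLeast G 2 → ∀ {D} →
    MinimalCertifiedDominating G D → MinimalDominating G D
  minimalCertifiedDominating⇒minimalDominating δ≥2 {D} D-mcd@((D-dom , D-cert) , D-minimal) =
    D-dom , λ D′ (D′⊆D , x , x∈D , x∉D′) D′-dom →
      D-minimal (D - x) (x∈p⇒p-x⊂p x∈D) (Dominating-⊆ (D′⊆D-x D′⊆D x∉D′) D′-dom , D-x-certified x)
    where
    D′⊆D-x : ∀ {D′ x} → D′ ⊆ D → x ∉ D′ → D′ ⊆ D - x
    D′⊆D-x D′⊆D x∉D′ u∈D′ = x∈p∧x≢y⇒x∈p-y (D′⊆D u∈D′) λ { refl → x∉D′ u∈D′ }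
    D-x-certified : ∀ x → Certified G (D - x)
    D-x-certified x v v∈ = let v∈D = p─q⊆p D ⁅ x ⁆ v∈ in
      inj₂ (TwoOutsideNeighbours-⊆ (p─q⊆p D ⁅ x ⁆)
              (certified⇒twoOutsideNeighbours D-cert v∈D
                (minimalCertifiedDominating⇒outsideNeighbour δ≥2 D-mcd v∈D)))

corollary3p6 : (n : ℕ) (G : Graph n) → MinDegreeAtLeast G 2 →
    (k : ℕ) → IndependenceNumber G k → UpperDomination G k →
    IndependenceNumber G k × UpperDomination G k × UpperCertifiedDomination G k
corollary3p6 n G δ≥2 k β₀≡k@((S , S-indep , ∣S∣≡k) , β₀-bound) Γ≡k@(_ , Γ-bound) =
  β₀≡k , Γ≡k , (S , S-mcd , ∣S∣≡k) , Γcer-bound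
  where
  S-mcd : MinimalCertifiedDominating G S
  S-mcd = maximum-independent⇒minimalCertifiedDominating G δ≥2 S-indep
            λ T T-indep → subst (∣ T ∣ ≤_) (≡-sym ∣S∣≡k) (β₀-bound T T-indep)
  Γcer-bound : ∀ D → MinimalCertifiedDominating G D → ∣ D ∣ ≤ k
  Γcer-bound D D-mcd = Γ-bound D (minimalCertifiedDominating⇒minimalDominating G δ≥2 D-mcd)
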